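{- Let $G$ be a biconnected graph all of whose parts are cycles. Then $\chi(G)\le 3$.
   Context: All graphs are finite, undirected, without loops or multiple edges; $G(U)$ is the subgraph induced on $U$; $\chi$ is the chromatic number. A connected component means the vertex set of a maximal connected subgraph. A set $R\subset V(G)$ is a cutset if $G-R$ (delete the vertices of $R$) is disconnected; $\mathfrak R_2(G)$ is the set of 2-vertex cutsets. $R$ separates $X$ from $Y$ (where $X,Y\not\subset R$) if no vertex of $X\setminus R$ and no vertex of $Y\setminus R$ lie in a common connected component of $G-R$; $R$ splits $X$ if $X\setminus R$ is not contained in one connected component of $G-R$. $G$ is biconnected if $v(G)>2$ and it has no cutset with at most one vertex. Cutsets $S,T\in\mathfrak R_2(G)$ are independent if neither splits the other; $S$ is single if it is independent with all other cutsets in $\mathfrak R_2(G)$; $\mathfrak O(G)$ is the set of single cutsets. A set $A\subset V(G)$ is a part of $G$ if no cutset of $\mathfrak O(G)$ splits $A$ but every vertex outside $A$ is separated from $A$ by some cutset of $\mathfrak O(G)$. $G'$ is obtained from $G$ by adding all edges $ab$ with $\{a,b\}\in\mathfrak O(G)$. A part $A$ is a cycle if $G'(A)$ is a simple cycle. -}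

module Defs where

open import Data.Nat using (ℕ; suc; _≤_; _>_)
open import Data.Nat.DivMod using (_%_)
open import Data.Fin using (Fin; toℕ)
open import Data.Fin.Subset using (Subset; _∈_; _∉_; _⊈_; ⁅_⁆; _∪_; ∣_∣)
open import Data.Product using (Σ; ∃; ∃-syntax; _×_; _,_)
open import Data.Sum using (_⊎_)
open import Relation.Nullary using (¬_)
open import Relation.Binary using (Decidable)
open import Relation.Binary.PropositionalEquality using (_≡_; _≢_)
open import Function.Definitions using (Injective)

record Graph (n : ℕ) : Set₁ where
  field
    Adj     : Fin n → Fin n → Set
    adj?    : Decidable Adj
    sym     : ∀ {u v} → Adj u v → Adj v u
    irrefl  : ∀ {u} → ¬ Adj u u
open Graph public

module _ {n : ℕ} (G : Graph n) where

  data Reach (R : Subset n) (u : Fin n) : Fin n → Set where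
    here : u ∉ R → Reach R u u
    step : ∀ {w v} → Reach R u w → Adj G w v → v ∉ R → Reach R u v

  Cutset : Subset n → Set
  Cutset R = ∃[ u ] ∃[ v ] (u ∉ R × v ∉ R × ¬ Reach R u v)

  Cutset₂ : Subset n → Set
  Cutset₂ R = ∣ R ∣ ≡ 2 × Cutset R

  Separates : Subset n → Subset n → Subset n → Set
  Separates R X Y = X ⊈ R × Y ⊈ R ×
    (∀ x y → x ∈ X → x ∉ R → y ∈ Y → y ∉ R → ¬ Reach R x y)

  Splits : Subset n → Subset n → Set
  Splits R X = ∃[ x ] ∃[ y ] (x ∈ X × x ∉ R × y ∈ X × y ∉ R × ¬ Reach R x y)

  Biconnected : Set
  Biconnected = n > 2 × (∀ R → ∣ R ∣ ≤ 1 → ¬ Cutset R)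

  Independent : Subset n → Subset n → Set
  Independent S T = ¬ Splits S T × ¬ Splits T S

  Single : Subset n → Set
  Single S = Cutset₂ S × (∀ T → Cutset₂ T → T ≢ S → Independent S T)

  Part : Subset n → Set
  Part A = (∀ S → Single S → ¬ Splits S A) ×
           (∀ v → v ∉ A → ∃[ S ] (Single S × Separates S ⁅ v ⁆ A))

  -- Adjacency of G' (G with all edges ab, {a,b} ∈ 𝔒(G), added).
  Adj' : Fin n → Fin n → Set
  Adj' a b = Adj G a b ⊎ (a ≢ b × Single (⁅ a ⁆ ∪ ⁅ b ⁆))

  -- G'(A) is a simple cycle: A is enumerated cyclically by an injective
  -- f : Fin k → Fin n (k ≥ 3) and the induced adjacency is exactly that of C_k.
  IsCycle : Subset n → Set
  IsCycle A = ∃[ m ] Σ (Fin (suc (suc (suc m))) → Fin n) λ f →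
      Injective _≡_ _≡_ f
    × (∀ v → v ∈ A → ∃[ i ] f i ≡ v)
    × (∀ i → f i ∈ A)
    × (∀ i j → (Adj' (f i) (f j) →
                  (toℕ j ≡ suc (toℕ i) % suc (suc (suc m))
                   ⊎ toℕ i ≡ suc (toℕ j) % suc (suc (suc m))))
             × ((toℕ j ≡ suc (toℕ i) % suc (suc (suc m))
                   ⊎ toℕ i ≡ suc (toℕ j) % suc (suc (suc m))) →
                  Adj' (f i) (f j)))

  ThreeColourable : Set
  ThreeColourable = Σ (Fin n → Fin 3) λ c → ∀ u v → Adj G u v → c u ≢ c v

module Submission where

-- We show that such a graph G is 2-degenerate: every nonempty vertex set W
-- contains a vertex with at most two neighbours in W; 2-degenerate graphs
-- are 3-colourable by greedy colouring (colour W - v first, then give v a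
-- colour missed by its at most two neighbours).
--
-- To find the low-degree vertex, call (S , c) a W-pocket if S is a single
-- cutset and the component of c in G - S meets W.  If there is no pocket,
-- either W lies inside a single cutset (so |W| ≤ 2), or there is no single
-- cutset at all and the whole vertex set is a part, hence a cycle.  Otherwise
-- take a pocket (S , c) whose component is as small as possible and let A
-- consist of S and of those vertices of that component that lie in no
-- component of another single cutset nested inside it.  A is a part, hence a
-- cycle of G'; minimality forces every vertex of W in the component into A,
-- so such a vertex w has all its W-neighbours among its two cycle neighbours.

open import Data.Nat using (ℕ; zero; suc; _≤_; _<_; _∸_; _%_; z≤n; s≤s; s≤s⁻¹; _<?_) renaming (_≟_ to _≟ℕ_)
open import Data.Nat.Properties
  using (≤-refl; <-irrefl; <-≤-trans; ≤-<-trans; suc-injective; ≤-reflexive; ≮⇒≥; <⇒≢; m≤n⇒m<n∨m≡n; ∸-monoʳ-<; m∸n≤m)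
open import Data.Nat.DivMod using (m<n⇒m%n≡m; n%n≡0; m%n<n)
open import Data.Bool using (if_then_else_)
import Data.Bool as Bool
open import Data.Fin using (Fin; zero; suc; toℕ; fromℕ<)
open import Data.Fin.Properties using (_≟_; any?; all?; toℕ<n; toℕ-injective; toℕ-fromℕ<)
open import Data.Fin.Subset
  using (Subset; inside; outside; _∈_; _∉_; _⊆_; _∪_; _-_; ⁅_⁆; ∣_∣; ⊤; Nonempty)
open import Data.Fin.Subset.Properties
  using (_∈?_; nonempty?; anySubset?; ∈⊤; x∈⁅x⁆; x∈⁅y⁆⇒x≡y; ⊆-antisym;
         p⊂q⇒∣p∣<∣q∣; x∈p⇒∣p-x∣<∣p∣; x∈p∧x≢y⇒x∈p-y; p─q⊆p; p⊆p∪q; q⊆p∪q; x∈p∪q⁻; ∣p∣≤n)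
open import Data.Vec using (_∷_; there; tabulate)
open import Data.Vec.Properties using (≡-dec; lookup∘tabulate; lookup⇒[]=; []=⇒lookup)
open import Data.Product using (∃; ∃₂; _×_; _,_; proj₁; proj₂)
open import Data.Sum using (_⊎_; inj₁; inj₂)
open import Data.Empty using (⊥-elim)
open import Function using (_∘_)
open import Relation.Nullary using (¬_; Dec; yes; no; does; contradiction)
open import Relation.Nullary.Decidable using (_×-dec_; _⊎-dec_; _→-dec_; ¬?)
open import Relation.Unary using (Decidable)
open import Relation.Binary.PropositionalEquality using (_≡_; _≢_; refl; sym; trans; subst)
open import Defs renaming (sym to adj-sym)

private variable
  n : ℕ

AtMostTwo : {A : Set} → (A → Set) → Set
AtMostTwo {A} P = ∃₂ λ (p q : A) → ∀ {y} → P y → y ≡ p ⊎ y ≡ q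

AtMostTwo-mono : {A : Set} {P Q : A → Set} → (∀ {y} → Q y → P y) → AtMostTwo P → AtMostTwo Q
AtMostTwo-mono Q⇒P (p , q , bound) = p , q , bound ∘ Q⇒P

AtMostTwo-image : {A B : Set} {P : A → Set} {Q : B → Set} (f : A → B) →
  AtMostTwo P → (∀ {y} → Q y → ∃ λ x → P x × f x ≡ y) → AtMostTwo Q
AtMostTwo-image {P = P} f (p , q , bound) cover = f p , f q , λ Qy → via (cover Qy)
  where
  via : ∀ {y} → (∃ λ x → P x × f x ≡ y) → y ≡ f p ⊎ y ≡ f q
  via (x , Px , refl) with bound Px
  ... | inj₁ refl = inj₁ refl
  ... | inj₂ refl = inj₂ refl

⟦_⟧ : {P : Fin n → Set} → Decidable P → Subset n
⟦ P? ⟧ = tabulate (λ x → if does (P? x) then inside else outside)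

∈⟦⟧⁺ : {P : Fin n → Set} (P? : Decidable P) {x : Fin n} → P x → x ∈ ⟦ P? ⟧
∈⟦⟧⁺ {P = P} P? {x} Px = lookup⇒[]= x _ (trans (lookup∘tabulate _ x) (decided (P? x)))
  where
  decided : (d : Dec (P x)) → (if does d then inside else outside) ≡ inside
  decided (yes _) = refl
  decided (no ¬Px) = contradiction Px ¬Px

∈⟦⟧⁻ : {P : Fin n → Set} (P? : Decidable P) {x : Fin n} → x ∈ ⟦ P? ⟧ → P x
∈⟦⟧⁻ {P = P} P? {x} x∈ = decided (P? x) (trans (sym (lookup∘tabulate _ x)) ([]=⇒lookup x∈))
  where
  decided : (d : Dec (P x)) → (if does d then inside else outside) ≡ inside → P x
  decided (yes Px) _ = Px
  decided (no _) ()

member⇒size>0 : {p : Subset n} {x : Fin n} → x ∈ p → 0 < ∣ p ∣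
member⇒size>0 x∈p = ≤-<-trans z≤n (x∈p⇒∣p-x∣<∣p∣ x∈p)

remove-shrinks : ∀ {k} {p : Subset n} {x : Fin n} → ∣ p ∣ ≤ suc k → x ∈ p → ∣ p - x ∣ ≤ k
remove-shrinks sz x∈p = s≤s⁻¹ (<-≤-trans (x∈p⇒∣p-x∣<∣p∣ x∈p) sz)

x∉p-x : (p : Subset n) (x : Fin n) → x ∉ p - x
x∉p-x (_ ∷ p) zero ()
x∉p-x (_ ∷ p) (suc x) (there x∈) = x∉p-x p x x∈

size≤1-unique : {p : Subset n} {x y : Fin n} → ∣ p ∣ ≤ 1 → x ∈ p → y ∈ p → x ≡ y
size≤1-unique {p = p} {x} {y} sz x∈p y∈p with x ≟ y
... | yes x≡y = x≡y
... | no x≢y = contradiction (<-≤-trans p-x-occupied (remove-shrinks sz x∈p)) (<-irrefl refl)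
  where
  p-x-occupied : 0 < ∣ p - x ∣
  p-x-occupied = member⇒size>0 (x∈p∧x≢y⇒x∈p-y y∈p (x≢y ∘ sym))

size≤2-pair : {p : Subset n} {a : Fin n} → ∣ p ∣ ≤ 2 → a ∈ p → AtMostTwo (_∈ p)
size≤2-pair {p = p} {a} sz a∈p with nonempty? (p - a)
... | no empty = a , a , λ {y} y∈p → inj₁ (is-a y∈p)
  where
  is-a : ∀ {y} → y ∈ p → y ≡ a
  is-a {y} y∈p with y ≟ a
  ... | yes y≡a = y≡a
  ... | no y≢a = contradiction (y , x∈p∧x≢y⇒x∈p-y y∈p y≢a) empty
... | yes (b , b∈p-a) = a , b , a-or-b
  where
  a-or-b : ∀ {y} → y ∈ p → y ≡ a ⊎ y ≡ b
  a-or-b {y} y∈p with y ≟ a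
  ... | yes y≡a = inj₁ y≡a
  ... | no y≢a = inj₂ (size≤1-unique (remove-shrinks sz a∈p) (x∈p∧x≢y⇒x∈p-y y∈p y≢a) b∈p-a)

difference-witness : (S T : Subset n) → ∣ S ∣ ≡ ∣ T ∣ → S ≢ T → ∃ λ s → s ∈ S × s ∉ T
difference-witness S T sizes S≢T with any? (λ s → (s ∈? S) ×-dec ¬? (s ∈? T))
... | yes witness = witness
... | no none = contradiction (⊆-antisym S⊆T T⊆S) S≢T
  where
  S⊆T : S ⊆ T
  S⊆T {x} x∈S with x ∈? T
  ... | yes x∈T = x∈T
  ... | no x∉T = contradiction (x , x∈S , x∉T) none
  T⊆S : T ⊆ S
  T⊆S {x} x∈T with x ∈? S
  ... | yes x∈S = x∈S
  ... | no x∉S = contradiction sizes (<⇒≢ (p⊂q⇒∣p∣<∣q∣ (S⊆T , x , x∈T , x∉S)))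

_≟ₛ_ : (S T : Subset n) → Dec (S ≡ T)
_≟ₛ_ = ≡-dec Bool._≟_

allSubset? : {P : Subset n → Set} → (∀ p → Dec (P p)) → Dec (∀ p → P p)
allSubset? P? with anySubset? (λ p → ¬? (P? p))
... | yes (p , ¬Pp) = no λ all → ¬Pp (all p)
... | no none = yes λ p → holds p (P? p)
  where
  holds : ∀ p → Dec _ → _
  holds p (yes Pp) = Pp
  holds p (no ¬Pp) = contradiction (p , ¬Pp) none

anyPair? : {P : Subset n × Fin n → Set} → Decidable P → Dec (∃ P)
anyPair? P? with anySubset? (λ S → any? (λ c → P? (S , c)))
... | yes (S , c , PSc) = yes ((S , c) , PSc)
... | no none = no λ { ((S , c) , PSc) → none (S , c , PSc) }

minimise : {A : Set} (P : A → Set) (μ : A → ℕ) → (∀ k → Dec (∃ λ a → P a × μ a < k)) →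
  ∃ P → ∃ λ a → P a × (∀ b → P b → μ a ≤ μ b)
minimise P μ below? (a , Pa) = descend (suc (μ a)) a Pa ≤-refl
  where
  descend : ∀ k a → P a → μ a < k → ∃ λ a → P a × (∀ b → P b → μ a ≤ μ b)
  descend (suc k) a Pa μa<k with below? (μ a)
  ... | yes (b , Pb , μb<μa) = descend k b Pb (<-≤-trans μb<μa (s≤s⁻¹ μa<k))
  ... | no none = a , Pa , λ b Pb → ≮⇒≥ (λ μb<μa → none (b , Pb , μb<μa))

-- Greedy 3-colouring of 2-degenerate graphs.

fresh-colour : (a b : Fin 3) → ∃ λ c → c ≢ a × c ≢ b
fresh-colour zero             zero             = suc zero , (λ ()) , (λ ())
fresh-colour zero             (suc zero)       = suc (suc zero) , (λ ()) , (λ ())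
fresh-colour zero             (suc (suc zero)) = suc zero , (λ ()) , (λ ())
fresh-colour (suc zero)       zero             = suc (suc zero) , (λ ()) , (λ ())
fresh-colour (suc zero)       (suc zero)       = zero , (λ ()) , (λ ())
fresh-colour (suc zero)       (suc (suc zero)) = zero , (λ ()) , (λ ())
fresh-colour (suc (suc zero)) zero             = suc zero , (λ ()) , (λ ())
fresh-colour (suc (suc zero)) (suc zero)       = zero , (λ ()) , (λ ())
fresh-colour (suc (suc zero)) (suc (suc zero)) = zero , (λ ()) , (λ ())

module _ (G : Graph n) where

  TwoDegenerate : Set
  TwoDegenerate = ∀ W → Nonempty W → ∃ λ v → v ∈ W × AtMostTwo (λ y → y ∈ W × Adj G v y)

  ProperOn : Subset n → (Fin n → Fin 3) → Set
  ProperOn W col = ∀ {u v} → u ∈ W → v ∈ W → Adj G u v → col u ≢ col v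

  colour-on : TwoDegenerate → ∀ k W → ∣ W ∣ ≤ k → ∃ (ProperOn W)
  colour-on degenerate k W size with nonempty? W
  colour-on degenerate k W size | no empty = (λ _ → zero) , λ u∈W _ _ → contradiction (_ , u∈W) empty
  colour-on degenerate zero W size | yes (w , w∈W) = contradiction (<-≤-trans (member⇒size>0 w∈W) size) (<-irrefl refl)
  colour-on degenerate (suc k) W size | yes nonempty
    with degenerate W nonempty
  ... | v , v∈W , p , q , neighbours
    with colour-on degenerate k (W - v) (remove-shrinks size v∈W)
  ... | col , proper = extended , extended-proper
    where
    new : ∃ λ c → c ≢ col p × c ≢ col q
    new = fresh-colour (col p) (col q)

    extended : Fin n → Fin 3
    extended x with x ≟ v
    ... | yes _ = proj₁ new
    ... | no _ = col x

    new-differs : ∀ {y} → y ∈ W → Adj G v y → proj₁ new ≢ col y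
    new-differs y∈W v~y with neighbours (y∈W , v~y)
    ... | inj₁ refl = proj₁ (proj₂ new)
    ... | inj₂ refl = proj₂ (proj₂ new)

    extended-proper : ProperOn W extended
    extended-proper {u} {u'} u∈W u'∈W u~u' with u ≟ v | u' ≟ v
    ... | yes refl | yes refl = λ _ → irrefl G u~u'
    ... | yes refl | no _     = new-differs u'∈W u~u'
    ... | no _     | yes refl = new-differs u∈W (adj-sym G u~u') ∘ sym
    ... | no u≢v   | no u'≢v  = proper (x∈p∧x≢y⇒x∈p-y u∈W u≢v) (x∈p∧x≢y⇒x∈p-y u'∈W u'≢v) u~u'

  two-degenerate⇒three-colourable : TwoDegenerate → ThreeColourable G
  two-degenerate⇒three-colourable degenerate with colour-on degenerate n ⊤ (∣p∣≤n ⊤)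
  ... | col , proper = col , λ u v u~v → proper ∈⊤ ∈⊤ u~v

suc-mod-injective : ∀ K a b → a < suc K → b < suc K → suc a % suc K ≡ suc b % suc K → a ≡ b
suc-mod-injective K a b a<N b<N eq with m≤n⇒m<n∨m≡n a<N | m≤n⇒m<n∨m≡n b<N
... | inj₁ a+1<N | inj₁ b+1<N = suc-injective (trans (sym (m<n⇒m%n≡m a+1<N)) (trans eq (m<n⇒m%n≡m b+1<N)))
... | inj₁ a+1<N | inj₂ refl with trans (sym (m<n⇒m%n≡m a+1<N)) (trans eq (n%n≡0 (suc K)))
...   | ()
suc-mod-injective K a b a<N b<N eq | inj₂ refl | inj₁ b+1<N
  with trans (sym (n%n≡0 (suc K))) (trans eq (m<n⇒m%n≡m b+1<N))
...   | ()
suc-mod-injective K a b a<N b<N eq | inj₂ a+1≡N | inj₂ b+1≡N = suc-injective (trans a+1≡N (sym b+1≡N))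

CyclicNeighbour : ∀ K → Fin (suc K) → Fin (suc K) → Set
CyclicNeighbour K i j = toℕ j ≡ suc (toℕ i) % suc K ⊎ toℕ i ≡ suc (toℕ j) % suc K

cyclic-suc : ∀ K → Fin (suc K) → Fin (suc K)
cyclic-suc K i = fromℕ< (m%n<n (suc (toℕ i)) (suc K))

cyclic-suc-unique : ∀ {K} {i j : Fin (suc K)} → toℕ j ≡ suc (toℕ i) % suc K → j ≡ cyclic-suc K i
cyclic-suc-unique j≡i+1 = toℕ-injective (trans j≡i+1 (sym (toℕ-fromℕ< _)))

-- Every index has at most two cyclic neighbours: its successor and, if it has
-- one, its predecessor (unique by injectivity of the successor).
cyclic-neighbours : ∀ K (i : Fin (suc K)) → AtMostTwo (CyclicNeighbour K i)
cyclic-neighbours K i with any? (λ j → toℕ i ≟ℕ suc (toℕ j) % suc K)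
... | yes (pred , i≡pred+1) = cyclic-suc K i , pred , neighbour
  where
  neighbour : ∀ {j} → CyclicNeighbour K i j → j ≡ cyclic-suc K i ⊎ j ≡ pred
  neighbour (inj₁ j≡i+1) = inj₁ (cyclic-suc-unique j≡i+1)
  neighbour {j} (inj₂ i≡j+1) =
    inj₂ (toℕ-injective (suc-mod-injective K _ _ (toℕ<n j) (toℕ<n pred) (trans (sym i≡j+1) i≡pred+1)))
... | no no-pred = cyclic-suc K i , cyclic-suc K i , neighbour
  where
  neighbour : ∀ {j} → CyclicNeighbour K i j → j ≡ cyclic-suc K i ⊎ j ≡ cyclic-suc K i
  neighbour (inj₁ j≡i+1) = inj₁ (cyclic-suc-unique j≡i+1)
  neighbour {j} (inj₂ i≡j+1) = contradiction (j , i≡j+1) no-pred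

cycle-degree : (G : Graph n) {A : Subset n} → IsCycle G A → ∀ {x} → x ∈ A →
  AtMostTwo (λ y → y ∈ A × Adj' G x y)
cycle-degree G {A} (m , f , _ , covers , _ , adjacency) x∈A with covers _ x∈A
... | i , refl = AtMostTwo-image f (cyclic-neighbours (suc (suc m)) i) preimage
  where
  preimage : ∀ {y} → y ∈ A × Adj' G (f i) y → ∃ λ j → CyclicNeighbour _ i j × f j ≡ y
  preimage (y∈A , fi~y) with covers _ y∈A
  ... | j , refl = j , proj₁ (adjacency i j) fi~y , refl

-- Reachability in G - R.

module _ (G : Graph n) where

  private variable
    R S T W X Y : Subset n
    c k s u v w x y z : Fin n

  reach-start : Reach G R u v → u ∉ R
  reach-start (here u∉R) = u∉R
  reach-start (step path _ _) = reach-start path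

  reach-end : Reach G R u v → v ∉ R
  reach-end (here v∉R) = v∉R
  reach-end (step _ _ v∉R) = v∉R

  reach-trans : Reach G R u w → Reach G R w v → Reach G R u v
  reach-trans path (here _) = path
  reach-trans path (step path' w~v v∉R) = step (reach-trans path path') w~v v∉R

  reach-sym : Reach G R u v → Reach G R v u
  reach-sym (here u∉R) = here u∉R
  reach-sym (step {w} path w~v v∉R) =
    reach-trans (step (here v∉R) (adj-sym G w~v) (reach-end path)) (reach-sym path)

  Closed : Subset n → Subset n → Set
  Closed R Y = ∀ {w v} → w ∈ Y → Adj G w v → v ∉ R → v ∈ Y

  closed-reach : Closed R Y → u ∈ Y → Reach G R u v → v ∈ Y
  closed-reach closed u∈Y (here _) = u∈Y
  closed-reach closed u∈Y (step path w~v v∉R) = closed (closed-reach closed u∈Y path) w~v v∉R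

  ReachableSet : Subset n → Fin n → Subset n → Set
  ReachableSet R u X = ∀ {v} → v ∈ X → Reach G R u v

  Boundary : Subset n → Subset n → Fin n → Set
  Boundary R X v = v ∉ R × ∃ λ w → w ∈ X × Adj G w v

  boundary? : ∀ R X → Decidable (Boundary R X)
  boundary? R X v = ¬? (v ∈? R) ×-dec any? (λ w → (w ∈? X) ×-dec adj? G w v)

  -- Adding the boundary of a reachable set until nothing new appears yields a
  -- closed reachable set; each round grows the set, so n + 1 - |X| rounds suffice.
  saturate : ∀ fuel X → n ∸ ∣ X ∣ < fuel → ReachableSet R u X →
    ∃ λ Y → ReachableSet R u Y × X ⊆ Y × Closed R Y
  saturate {R = R} (suc fuel) X bound reachable
    with any? (λ v → boundary? R X v ×-dec ¬? (v ∈? X))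
  ... | no nothing-new = X , reachable , (λ v∈X → v∈X) , closed
    where
    closed : Closed R X
    closed {w} {v} w∈X w~v v∉R with v ∈? X
    ... | yes v∈X = v∈X
    ... | no v∉X = contradiction (v , (v∉R , w , w∈X , w~v) , v∉X) nothing-new
  ... | yes (v , v-boundary , v∉X)
    with saturate fuel (X ∪ ⟦ boundary? R X ⟧) smaller reachable'
    where
    grows : ∣ X ∣ < ∣ X ∪ ⟦ boundary? R X ⟧ ∣
    grows = p⊂q⇒∣p∣<∣q∣ (p⊆p∪q _ , v , q⊆p∪q X _ (∈⟦⟧⁺ (boundary? R X) v-boundary) , v∉X)
    smaller : n ∸ ∣ X ∪ ⟦ boundary? R X ⟧ ∣ < fuel
    smaller = <-≤-trans (∸-monoʳ-< grows (∣p∣≤n (X ∪ ⟦ boundary? R X ⟧))) (s≤s⁻¹ bound)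
    reachable' : ReachableSet R _ (X ∪ ⟦ boundary? R X ⟧)
    reachable' v∈ with x∈p∪q⁻ X _ v∈
    ... | inj₁ v∈X = reachable v∈X
    ... | inj₂ v∈B with ∈⟦⟧⁻ (boundary? R X) v∈B
    ...   | v∉R , w , w∈X , w~v = step (reachable w∈X) w~v v∉R
  ... | Y , reachable-Y , X∪B⊆Y , closed = Y , reachable-Y , (X∪B⊆Y ∘ p⊆p∪q _) , closed

  reach? : ∀ R u v → Dec (Reach G R u v)
  reach? R u v with u ∈? R
  ... | yes u∈R = no λ path → reach-start path u∈R
  ... | no u∉R with saturate (suc n) ⁅ u ⁆ (s≤s (m∸n≤m n ∣ ⁅ u ⁆ ∣)) from-u
    where
    from-u : ReachableSet R u ⁅ u ⁆
    from-u v∈⁅u⁆ = subst (Reach G R u) (sym (x∈⁅y⁆⇒x≡y u v∈⁅u⁆)) (here u∉R)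
  ... | Y , reachable , ⁅u⁆⊆Y , closed with v ∈? Y
  ...   | yes v∈Y = yes (reachable v∈Y)
  ...   | no v∉Y = no λ path → v∉Y (closed-reach closed (⁅u⁆⊆Y (x∈⁅x⁆ u)) path)

  component : Subset n → Fin n → Subset n
  component S c = ⟦ reach? S c ⟧

  cutset? : ∀ R → Dec (Cutset G R)
  cutset? R = any? λ u → any? λ v → ¬? (u ∈? R) ×-dec ¬? (v ∈? R) ×-dec ¬? (reach? R u v)

  cutset₂? : ∀ R → Dec (Cutset₂ G R)
  cutset₂? R = (∣ R ∣ ≟ℕ 2) ×-dec cutset? R

  splits? : ∀ R X → Dec (Splits G R X)
  splits? R X = any? λ x → any? λ y →
    (x ∈? X) ×-dec ¬? (x ∈? R) ×-dec (y ∈? X) ×-dec ¬? (y ∈? R) ×-dec ¬? (reach? R x y)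

  single? : ∀ S → Dec (Single G S)
  single? S = cutset₂? S ×-dec allSubset? λ T →
    cutset₂? T →-dec ¬? (T ≟ₛ S) →-dec ¬? (splits? S T) ×-dec ¬? (splits? T S)

  -- In a biconnected graph each vertex s of a 2-cutset S has a neighbour in
  -- every component of G - S; otherwise S - s would be a cutset of size one.
  neighbour-in-component : Biconnected G → ∣ S ∣ ≡ 2 → s ∈ S → c ∉ S →
    ∃ λ y → Adj G s y × Reach G S c y
  neighbour-in-component {S = S} {s = s} {c = c} (_ , no-small-cutset) size s∈S c∉S
    with any? (λ y → adj? G s y ×-dec reach? S c y)
  ... | yes found = found
  ... | no none = ⊥-elim (no-small-cutset (S - s) (remove-shrinks (≤-reflexive size) s∈S)
                    (c , s , c∉S ∘ p─q⊆p S ⁅ s ⁆ , x∉p-x S s , λ path → reach-end (avoids-S path) s∈S))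
    where
    -- A path from c in G - (S - s) cannot enter s, so it avoids all of S.
    avoids-S : ∀ {w} → Reach G (S - s) c w → Reach G S c w
    avoids-S (here _) = here c∉S
    avoids-S {w} (step {w'} path w'~w w∉S-s) with w ∈? S
    ... | no w∉S = step (avoids-S path) w'~w w∉S
    ... | yes w∈S with w ≟ s
    ...   | no w≢s = contradiction (x∈p∧x≢y⇒x∈p-y w∈S w≢s) w∉S-s
    ...   | yes refl = contradiction (w' , adj-sym G w'~w , avoids-S path) none

  -- Let T not split S and s ∈ S - T.  A component of G - T not containing s
  -- contains no vertex of S, so it stays inside the component of G - S it meets.
  trapped-component : ¬ Splits G T S → s ∈ S → s ∉ T → ¬ Reach G T s x →
    Reach G S c x → Reach G T x z → Reach G S c z
  trapped-component no-split s∈S s∉T s↛x c→x (here _) = c→x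
  trapped-component {T = T} {S = S} {s = s} {z = z} no-split s∈S s∉T s↛x c→x (step path w~z z∉T)
    with z ∈? S
  ... | no z∉S = step (trapped-component no-split s∈S s∉T s↛x c→x path) w~z z∉S
  ... | yes z∈S with reach? T s z
  ...   | yes s→z = contradiction (reach-trans s→z (reach-sym (step path w~z z∉T))) s↛x
  ...   | no s↛z = contradiction (s , z , s∈S , s∉T , z∈S , z∉T , s↛z) no-split

  nested-component-smaller : Biconnected G → ∣ S ∣ ≡ 2 → ∣ T ∣ ≡ 2 → T ≢ S → c ∉ S →
    (∀ z → Reach G T k z → Reach G S c z) → ∣ component T k ∣ < ∣ component S c ∣
  nested-component-smaller {S = S} {T = T} {c = c} {k = k} biconnected |S|≡2 |T|≡2 T≢S c∉S nested
    with difference-witness S T (trans |S|≡2 (sym |T|≡2)) (T≢S ∘ sym)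
  ... | s , s∈S , s∉T with neighbour-in-component biconnected |S|≡2 s∈S c∉S
  ...   | y , s~y , c→y = p⊂q⇒∣p∣<∣q∣ (inclusion , y , ∈⟦⟧⁺ (reach? S c) c→y , y∉component)
    where
    inclusion : component T k ⊆ component S c
    inclusion z∈ = ∈⟦⟧⁺ (reach? S c) (nested _ (∈⟦⟧⁻ (reach? T k) z∈))
    -- otherwise s, a vertex of S, would lie in the component of c in G - S
    y∉component : y ∉ component T k
    y∉component y∈ = reach-end (nested s (step (∈⟦⟧⁻ (reach? T k) y∈) (adj-sym G s~y) s∉T)) s∈S

  -- The part cut out by a minimal pocket.

  Pocket : Subset n → Subset n × Fin n → Set
  Pocket W (S , c) = Single G S × ∃ λ w → w ∈ W × Reach G S c w

  pocket? : ∀ W → Decidable (Pocket W)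
  pocket? W (S , c) = single? S ×-dec any? (λ w → (w ∈? W) ×-dec reach? S c w)

  pocket-size : Subset n × Fin n → ℕ
  pocket-size (S , c) = ∣ component S c ∣

  module MinimalPocket (biconnected : Biconnected G) (W S : Subset n) (c : Fin n)
    (S-single : Single G S) (w₀ : Fin n) (w₀∈W : w₀ ∈ W) (c→w₀ : Reach G S c w₀)
    (minimal : ∀ T k → Pocket W (T , k) → ∣ component S c ∣ ≤ ∣ component T k ∣) where

    c∉S : c ∉ S
    c∉S = reach-start c→w₀

    same-size : ∀ {T} → Single G T → ∣ S ∣ ≡ ∣ T ∣
    same-size T-single = trans (proj₁ (proj₁ S-single)) (sym (proj₁ (proj₁ T-single)))

    Inner : Fin n → Set
    Inner x = ∃₂ λ T k → Single G T × T ≢ S × Reach G T k x × (∀ z → Reach G T k z → Reach G S c z)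

    inner? : Decidable Inner
    inner? x = anySubset? λ T → any? λ k →
      single? T ×-dec ¬? (T ≟ₛ S) ×-dec reach? T k x ×-dec all? (λ z → reach? T k z →-dec reach? S c z)

    InA : Fin n → Set
    InA x = x ∈ S ⊎ (Reach G S c x × ¬ Inner x)

    inA? : Decidable InA
    inA? x = (x ∈? S) ⊎-dec (reach? S c x ×-dec ¬? (inner? x))

    A : Subset n
    A = ⟦ inA? ⟧

    S⊆A : S ⊆ A
    S⊆A x∈S = ∈⟦⟧⁺ inA? (inj₁ x∈S)

    A-reach : ∀ {x} → x ∈ A → x ∉ S → Reach G S c x
    A-reach x∈A x∉S with ∈⟦⟧⁻ inA? x∈A
    ... | inj₁ x∈S = contradiction x∈S x∉S
    ... | inj₂ (c→x , _) = c→x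

    -- By minimality of the pocket, the vertices of W in the component are not inner.
    W∩component⊆A : ∀ {y} → y ∈ W → Reach G S c y → y ∈ A
    W∩component⊆A {y} y∈W c→y = ∈⟦⟧⁺ inA? (inj₂ (c→y , not-inner))
      where
      not-inner : ¬ Inner y
      not-inner (T , k , T-single , T≢S , k→y , nested) = <-irrefl refl (<-≤-trans
        (nested-component-smaller biconnected (proj₁ (proj₁ S-single)) (proj₁ (proj₁ T-single)) T≢S c∉S nested)
        (minimal T k (T-single , y , y∈W , k→y)))

    -- No single cutset T splits A: for T ≠ S, every vertex of A - T is joined in
    -- G - T to a vertex s ∈ S - T, since otherwise it would be inner.
    A-unsplit : ∀ T → Single G T → ¬ Splits G T A
    A-unsplit T T-single (x , y , x∈A , x∉T , y∈A , y∉T , x↛y) with T ≟ₛ S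
    ... | yes refl = x↛y (reach-trans (reach-sym (A-reach x∈A x∉T)) (A-reach y∈A y∉T))
    ... | no T≢S with difference-witness S T (same-size T-single) (T≢S ∘ sym)
    ...   | s , s∈S , s∉T = x↛y (reach-trans (reach-sym (from-s x∈A x∉T)) (from-s y∈A y∉T))
      where
      T-no-split : ¬ Splits G T S
      T-no-split = proj₂ (proj₂ S-single T (proj₁ T-single) T≢S)
      from-s : ∀ {x} → x ∈ A → x ∉ T → Reach G T s x
      from-s {x} x∈A x∉T with reach? T s x | ∈⟦⟧⁻ inA? x∈A
      ... | yes s→x | _ = s→x
      ... | no s↛x | inj₁ x∈S = contradiction (s , x , s∈S , s∉T , x∈S , x∉T , s↛x) T-no-split
      ... | no s↛x | inj₂ (c→x , not-inner) =
        contradiction (T , x , T-single , T≢S , here x∉T ,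
                       λ z → trapped-component T-no-split s∈S s∉T s↛x c→x)
                      not-inner

    -- A vertex v outside A is separated from A by S if it is outside the
    -- component of c, and otherwise by the cutset witnessing that v is inner.
    A-separated : ∀ v → v ∉ A → ∃ λ T → Single G T × Separates G T ⁅ v ⁆ A
    A-separated v v∉A with reach? S c v
    ... | no c↛v = S , S-single , (λ ⁅v⁆⊆S → v∉A (S⊆A (⁅v⁆⊆S (x∈⁅x⁆ v)))) ,
                   (λ A⊆S → reach-end c→w₀ (A⊆S (W∩component⊆A w₀∈W c→w₀))) , separated
      where
      separated : ∀ x y → x ∈ ⁅ v ⁆ → x ∉ S → y ∈ A → y ∉ S → ¬ Reach G S x y
      separated x y x∈⁅v⁆ _ y∈A y∉S x→y with x∈⁅y⁆⇒x≡y v x∈⁅v⁆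
      ... | refl = c↛v (reach-trans (A-reach y∈A y∉S) (reach-sym x→y))
    ... | yes c→v with inner? v
    ...   | no not-inner = contradiction (∈⟦⟧⁺ inA? (inj₂ (c→v , not-inner))) v∉A
    ...   | yes (T , k , T-single , T≢S , k→v , nested) =
      T , T-single , (λ ⁅v⁆⊆T → reach-end k→v (⁅v⁆⊆T (x∈⁅x⁆ v))) , A⊈T , separated
      where
      A⊈T : ¬ A ⊆ T
      A⊈T A⊆T with difference-witness S T (same-size T-single) (T≢S ∘ sym)
      ... | s , s∈S , s∉T = s∉T (A⊆T (S⊆A s∈S))
      separated : ∀ x y → x ∈ ⁅ v ⁆ → x ∉ T → y ∈ A → y ∉ T → ¬ Reach G T x y
      separated x y x∈⁅v⁆ _ y∈A _ x→y with x∈⁅y⁆⇒x≡y v x∈⁅v⁆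
      ... | refl with ∈⟦⟧⁻ inA? y∈A
      ...   | inj₁ y∈S = reach-end (nested y (reach-trans k→v x→y)) y∈S
      ...   | inj₂ (_ , not-inner) = not-inner (T , k , T-single , T≢S , reach-trans k→v x→y , nested)

    A-part : Part G A
    A-part = A-unsplit , A-separated

    -- When A is a cycle, w₀ has at most two neighbours in W: they all lie in A.
    w₀-low-degree : IsCycle G A → AtMostTwo (λ y → y ∈ W × Adj G w₀ y)
    w₀-low-degree A-cycle = AtMostTwo-mono in-A (cycle-degree G A-cycle (W∩component⊆A w₀∈W c→w₀))
      where
      in-A : ∀ {y} → y ∈ W × Adj G w₀ y → y ∈ A × Adj' G w₀ y
      in-A {y} (y∈W , w₀~y) with y ∈? S
      ... | yes y∈S = S⊆A y∈S , inj₁ w₀~y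
      ... | no y∉S = W∩component⊆A y∈W (step c→w₀ w₀~y y∉S) , inj₁ w₀~y

  module _ (biconnected : Biconnected G) (cycles : ∀ A → Part G A → IsCycle G A) where

    pocket-case : ∃ (Pocket W) → ∃ λ v → v ∈ W × AtMostTwo (λ y → y ∈ W × Adj G v y)
    pocket-case {W = W} pocket
      with minimise (Pocket W) pocket-size
             (λ k → anyPair? (λ Sc → pocket? W Sc ×-dec (pocket-size Sc <? k))) pocket
    ... | (S , c) , (S-single , w₀ , w₀∈W , c→w₀) , least =
      w₀ , w₀∈W , w₀-low-degree (cycles A A-part)
      where open MinimalPocket biconnected W S c S-single w₀ w₀∈W c→w₀ (λ T k → least (T , k))

    -- Without pockets, W lies inside any single cutset, which has two vertices.
    single-case : ∀ S → Single G S → ¬ ∃ (Pocket W) → w ∈ W → AtMostTwo (λ y → y ∈ W × Adj G w y)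
    single-case {W = W} S S-single no-pocket w∈W =
      AtMostTwo-mono (W⊆S ∘ proj₁) (size≤2-pair (≤-reflexive (proj₁ (proj₁ S-single))) (W⊆S w∈W))
      where
      W⊆S : W ⊆ S
      W⊆S {y} y∈W with y ∈? S
      ... | yes y∈S = y∈S
      ... | no y∉S = contradiction ((S , y) , S-single , y , y∈W , here y∉S) no-pocket

    -- Without single cutsets the whole vertex set is a part, hence a cycle.
    no-single-case : ¬ ∃ (Single G) → AtMostTwo (λ y → y ∈ W × Adj G w y)
    no-single-case no-single =
      AtMostTwo-mono (λ (_ , w~y) → ∈⊤ , inj₁ w~y) (cycle-degree G (cycles ⊤ whole-part) ∈⊤)
      where
      whole-part : Part G ⊤
      whole-part = (λ S S-single _ → no-single (S , S-single)) , (λ v v∉⊤ → contradiction ∈⊤ v∉⊤)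

    two-degenerate : TwoDegenerate G
    two-degenerate W (w , w∈W) with anyPair? (pocket? W) | anySubset? single?
    ... | yes pocket | _ = pocket-case pocket
    ... | no no-pocket | yes (S , S-single) = w , w∈W , single-case S S-single no-pocket w∈W
    ... | no no-pocket | no no-single = w , w∈W , no-single-case no-single

corollary3 : ∀ {n} (G : Graph n) → Biconnected G →
    (∀ A → Part G A → IsCycle G A) → ThreeColourable G
corollary3 G biconnected cycles = two-degenerate⇒three-colourable G (two-degenerate G biconnected cycles)
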